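{- $\mathcal A_{11} \cap \mathcal S = \mathcal{SL}$.
   Context: An $\mathcal I$-zroupoid is an algebra $\langle A,\to,0\rangle$ ($\to$ binary, $0$ constant) satisfying $(x \to y) \to z \approx [(z' \to x) \to (y \to z)']'$ and $0''\approx 0$, where $x' := x \to 0$; $\mathcal I$ is their variety. Put $x \wedge y := (x \to y')'$. $\mathcal S$ is the variety of $\mathcal I$-zroupoids satisfying $x''\approx x$ and $x\wedge y \approx y \wedge x$. $\mathcal A_{11}$ is the subvariety of $\mathcal I$ defined by $(x \to y) \to z \approx (x \to z) \to y$. $\mathcal{SL}$ is the subvariety of $\mathcal I$ defined by $x' \approx x$ and $x \to y \approx y \to x$. -}

module Defs where

open import Level using (Level)
open import Data.Product using (_×_)
open import Relation.Binary.PropositionalEquality using (_≡_)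

module _ {a : Level} {A : Set a} (_⇒_ : A → A → A) (𝟘 : A) where


  _′ : A → A
  x ′ = x ⇒ 𝟘

  _∧_ : A → A → A
  x ∧ y = (x ⇒ (y ′)) ′

  IsIZroupoid : Set a
  IsIZroupoid =
    (∀ x y z → (x ⇒ y) ⇒ z ≡ ((((z ′) ⇒ x) ⇒ ((y ⇒ z) ′)) ′))
    × ((𝟘 ′) ′ ≡ 𝟘)

  IsS : Set a
  IsS = IsIZroupoid × (∀ x → (x ′) ′ ≡ x) × (∀ x y → x ∧ y ≡ y ∧ x)

  IsA11 : Set a
  IsA11 = IsIZroupoid × (∀ x y z → (x ⇒ y) ⇒ z ≡ (x ⇒ z) ⇒ y)

  IsSL : Set a
  IsSL = IsIZroupoid × (∀ x → x ′ ≡ x) × (∀ x y → x ⇒ y ≡ y ⇒ x)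

-- In 𝓢 the commutativity of ∧ and x'' = x give the contraposition law
-- x → y = y' → x', so 1 := 0' is a left unit for →.  The 𝓐₁₁ law
-- (1 → y) → z = (1 → z) → y then makes → commutative, and the defining
-- identity of 𝓘 at x = 1, y = 0 yields x' → x = x, whence x' = x.
-- Conversely, in 𝓢𝓛 the defining identity reads (x → y) → z = (z → x) → (y → z)
-- for a commutative operation with unit 0; this forces → to be associative
-- (indeed a semilattice operation), and 𝓐₁₁ follows from commutativity and
-- associativity, while the 𝓢 laws are immediate.
module Submission where

open import Defs using (IsS; IsA11; IsSL)
open import Level using (Level)
open import Data.Product using (_×_; _,_)
open import Function.Bundles using (_⇔_; mk⇔)
open import Relation.Binary.PropositionalEquality
open import Relation.Binary.PropositionalEquality.Algebra using (isMagma)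
open import Algebra.Bundles using (CommutativeSemigroup)

module _ {a : Level} {A : Set a} (_∙_ : A → A → A) where
  open import Algebra.Definitions {A = A} _≡_
  open ≡-Reasoning

  leftIdentity∧rightPermutable⇒comm : ∀ {e} → LeftIdentity e _∙_ →
    (∀ x y z → (x ∙ y) ∙ z ≡ (x ∙ z) ∙ y) → Commutative _∙_
  leftIdentity∧rightPermutable⇒comm {e} identityˡ permute x y = begin
    x ∙ y       ≡⟨ cong (_∙ y) (identityˡ x) ⟨
    (e ∙ x) ∙ y ≡⟨ permute e x y ⟩
    (e ∙ y) ∙ x ≡⟨ cong (_∙ x) (identityˡ y) ⟩
    y ∙ x       ∎

  comm∧assoc⇒rightPermutable : Commutative _∙_ → Associative _∙_ →
    ∀ x y z → (x ∙ y) ∙ z ≡ (x ∙ z) ∙ y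
  comm∧assoc⇒rightPermutable comm assoc = xy∙z≈xz∙y
    where
    commutativeSemigroup : CommutativeSemigroup a a
    commutativeSemigroup = record
      { isCommutativeSemigroup = record
        { isSemigroup = record { isMagma = isMagma _∙_ ; assoc = assoc }
        ; comm = comm
        }
      }
    open import Algebra.Properties.CommutativeSemigroup commutativeSemigroup
      using (xy∙z≈xz∙y)

  module Rotation (comm : Commutative _∙_) {e : A} (identityʳ : RightIdentity e _∙_)
    (rotate : ∀ x y z → (x ∙ y) ∙ z ≡ (z ∙ x) ∙ (y ∙ z)) where

    x∙y≡yx∙y : ∀ x y → x ∙ y ≡ (y ∙ x) ∙ y
    x∙y≡yx∙y x y = begin
      x ∙ y             ≡⟨ cong (_∙ y) (identityʳ x) ⟨
      (x ∙ e) ∙ y       ≡⟨ rotate x e y ⟩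
      (y ∙ x) ∙ (e ∙ y) ≡⟨ cong ((y ∙ x) ∙_) (trans (comm e y) (identityʳ y)) ⟩
      (y ∙ x) ∙ y       ∎

    xy∙y≡x∙y : ∀ x y → (x ∙ y) ∙ y ≡ x ∙ y
    xy∙y≡x∙y x y = trans (cong (_∙ y) (comm x y)) (sym (x∙y≡yx∙y x y))

    x∙xy≡x∙y : ∀ x y → x ∙ (x ∙ y) ≡ x ∙ y
    x∙xy≡x∙y x y = begin
      x ∙ (x ∙ y) ≡⟨ comm x (x ∙ y) ⟩
      (x ∙ y) ∙ x ≡⟨ cong (_∙ x) (comm x y) ⟩
      (y ∙ x) ∙ x ≡⟨ xy∙y≡x∙y y x ⟩
      y ∙ x       ≡⟨ comm y x ⟩
      x ∙ y       ∎

    assoc : Associative _∙_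
    assoc x y z = begin
      (x ∙ y) ∙ z                   ≡⟨ rotate x y z ⟩
      (z ∙ x) ∙ (y ∙ z)             ≡⟨ rotate z x (y ∙ z) ⟩
      ((y ∙ z) ∙ z) ∙ (x ∙ (y ∙ z)) ≡⟨ cong₂ _∙_ (xy∙y≡x∙y y z) (comm x (y ∙ z)) ⟩
      (y ∙ z) ∙ ((y ∙ z) ∙ x)       ≡⟨ x∙xy≡x∙y (y ∙ z) x ⟩
      (y ∙ z) ∙ x                   ≡⟨ comm (y ∙ z) x ⟩
      x ∙ (y ∙ z)                   ∎

module Zroupoid {a : Level} {A : Set a} (_⇒_ : A → A → A) (𝟘 : A) where
  open import Algebra.Definitions {A = A} _≡_
  open ≡-Reasoning

  -- Definitionally the _′ and _∧_ of Defs, but usable as operators and with a fixity.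
  infix 25 _′
  _′ : A → A
  x ′ = x ⇒ 𝟘

  _∧_ : A → A → A
  x ∧ y = (x ⇒ y ′) ′

  ZroupoidLaw : Set a
  ZroupoidLaw = ∀ x y z → (x ⇒ y) ⇒ z ≡ ((z ′ ⇒ x) ⇒ (y ⇒ z) ′) ′

  module InS (′-involutive : Involutive _′) (∧-comm : Commutative _∧_) where

    ′-injective : ∀ {x y} → x ′ ≡ y ′ → x ≡ y
    ′-injective {x} {y} x′≡y′ =
      trans (sym (′-involutive x)) (trans (cong _′ x′≡y′) (′-involutive y))

    contraposition : ∀ x y → x ⇒ y ≡ y ′ ⇒ x ′
    contraposition x y = begin
      x ⇒ y       ≡⟨ cong (x ⇒_) (′-involutive y) ⟨
      x ⇒ y ′ ′   ≡⟨ ′-injective (∧-comm x (y ′)) ⟩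
      y ′ ⇒ x ′   ∎

    𝟘′-identityˡ : LeftIdentity (𝟘 ′) _⇒_
    𝟘′-identityˡ x = begin
      𝟘 ′ ⇒ x       ≡⟨ cong (𝟘 ′ ⇒_) (′-involutive x) ⟨
      𝟘 ′ ⇒ x ′ ′   ≡⟨ contraposition (x ′) 𝟘 ⟨
      x ′ ′         ≡⟨ ′-involutive x ⟩
      x             ∎

    module _ (zroupoid : ZroupoidLaw) (comm : Commutative _⇒_) where

      x′⇒x≡x : ∀ x → x ′ ⇒ x ≡ x
      x′⇒x≡x x = ′-injective (begin
        (x ′ ⇒ x) ′                   ≡⟨ cong₂ (λ u v → (u ⇒ v) ′) x′⇒𝟘′≡x′ 𝟘⇒x′≡x ⟨
        ((x ′ ⇒ 𝟘 ′) ⇒ (𝟘 ⇒ x) ′) ′   ≡⟨ zroupoid (𝟘 ′) 𝟘 x ⟨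
        (𝟘 ′ ⇒ 𝟘) ⇒ x                 ≡⟨ cong (_⇒ x) (′-involutive 𝟘) ⟩
        𝟘 ⇒ x                         ≡⟨ comm 𝟘 x ⟩
        x ′                           ∎)
        where
        x′⇒𝟘′≡x′ : x ′ ⇒ 𝟘 ′ ≡ x ′
        x′⇒𝟘′≡x′ = trans (comm (x ′) (𝟘 ′)) (𝟘′-identityˡ (x ′))
        𝟘⇒x′≡x : (𝟘 ⇒ x) ′ ≡ x
        𝟘⇒x′≡x = trans (cong _′ (comm 𝟘 x)) (′-involutive x)

      𝟘-identityʳ : RightIdentity 𝟘 _⇒_
      𝟘-identityʳ x = begin
        x ′             ≡⟨ x′⇒x≡x (x ′) ⟨
        x ′ ′ ⇒ x ′     ≡⟨ cong (_⇒ x ′) (′-involutive x) ⟩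
        x ⇒ x ′         ≡⟨ comm x (x ′) ⟩
        x ′ ⇒ x         ≡⟨ x′⇒x≡x x ⟩
        x               ∎

  module InSL (zroupoid : ZroupoidLaw) (𝟘-identityʳ : RightIdentity 𝟘 _⇒_)
    (comm : Commutative _⇒_) where

    ′-involutive : Involutive _′
    ′-involutive x = trans (𝟘-identityʳ (x ′)) (𝟘-identityʳ x)

    ∧-comm : Commutative _∧_
    ∧-comm x y = begin
      (x ⇒ y ′) ′ ≡⟨ 𝟘-identityʳ (x ⇒ y ′) ⟩
      x ⇒ y ′     ≡⟨ cong (x ⇒_) (𝟘-identityʳ y) ⟩
      x ⇒ y       ≡⟨ comm x y ⟩
      y ⇒ x       ≡⟨ cong (y ⇒_) (𝟘-identityʳ x) ⟨
      y ⇒ x ′     ≡⟨ 𝟘-identityʳ (y ⇒ x ′) ⟨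
      (y ⇒ x ′) ′ ∎

    ⇒-rotate : ∀ x y z → (x ⇒ y) ⇒ z ≡ (z ⇒ x) ⇒ (y ⇒ z)
    ⇒-rotate x y z = begin
      (x ⇒ y) ⇒ z                 ≡⟨ zroupoid x y z ⟩
      ((z ′ ⇒ x) ⇒ (y ⇒ z) ′) ′   ≡⟨ 𝟘-identityʳ _ ⟩
      (z ′ ⇒ x) ⇒ (y ⇒ z) ′       ≡⟨ cong₂ (λ u v → (u ⇒ x) ⇒ v) (𝟘-identityʳ z) (𝟘-identityʳ (y ⇒ z)) ⟩
      (z ⇒ x) ⇒ (y ⇒ z)           ∎

    rightPermutable : ∀ x y z → (x ⇒ y) ⇒ z ≡ (x ⇒ z) ⇒ y
    rightPermutable = comm∧assoc⇒rightPermutable _⇒_ comm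
      (Rotation.assoc _⇒_ comm 𝟘-identityʳ ⇒-rotate)

lemma5p4 : ∀ {a : Level} {A : Set a} (_⇒_ : A → A → A) (𝟘 : A) →
    (IsA11 _⇒_ 𝟘 × IsS _⇒_ 𝟘) ⇔ IsSL _⇒_ 𝟘
lemma5p4 _⇒_ 𝟘 = mk⇔ A11∩S⊆SL SL⊆A11∩S
  where
  open Zroupoid _⇒_ 𝟘

  A11∩S⊆SL : IsA11 _⇒_ 𝟘 × IsS _⇒_ 𝟘 → IsSL _⇒_ 𝟘
  A11∩S⊆SL ((isI@(zroupoid , _) , permute) , (_ , ′-involutive , ∧-comm)) =
    isI , 𝟘-identityʳ zroupoid comm , comm
    where
    open InS ′-involutive ∧-comm
    comm : ∀ x y → x ⇒ y ≡ y ⇒ x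
    comm = leftIdentity∧rightPermutable⇒comm _⇒_ 𝟘′-identityˡ permute

  SL⊆A11∩S : IsSL _⇒_ 𝟘 → IsA11 _⇒_ 𝟘 × IsS _⇒_ 𝟘
  SL⊆A11∩S (isI@(zroupoid , _) , 𝟘-identityʳ , comm) =
    (isI , rightPermutable) , (isI , ′-involutive , ∧-comm)
    where open InSL zroupoid 𝟘-identityʳ comm
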